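{- Let $r:L\rightharpoonup R$ be a morphism and $m:R\to G$ a total injective morphism. The set of pushout complements $G'$ of $r$ and $m$ whose morphism $m':L\to G'$ is total and injective has finitely many minimal elements with respect to $\sqsubseteq$ (up to isomorphism), and these minimal elements are computable.
   Context: A graph is $G=(V_G,E_G,c_G,l_G)$ over a finite label set $\Lambda$ with arity $\mathrm{ar}:\Lambda\to\mathbb{N}$: finite $V_G,E_G$, $c_G:E_G\to V_G^*$, $l_G:E_G\to\Lambda$, $|c_G(e)|=\mathrm{ar}(l_G(e))$. A morphism $\varphi:G\rightharpoonup G'$ is a pair of partial functions on nodes and edges such that whenever $\varphi_E(e)$ is defined, $\varphi_V$ is defined on all nodes of $c_G(e)$, labels are preserved and $\varphi_V(c_G(e))=c_{G'}(\varphi_E(e))$; total/injective/surjective if both components are. A subgraph morphism is partial, injective and surjective; $G_1\sqsubseteq G_2$ iff there is a subgraph morphism $G_2\rightharpoonup G_1$. Pushout of $\varphi:G_0\rightharpoonup G_1,\psi:G_0\rightharpoonup G_2$ in the category of graphs and partial morphisms: $G_3$ with $\psi':G_1\rightharpoonup G_3$, $\varphi':G_2\rightharpoonup G_3$, $\psi'\circ\varphi=\varphi'\circ\psi$, universal among such commuting pairs. A pushout complement of $r:L\rightharpoonup R$ and $m:R\to G$ is a graph $G'$ with morphisms $m':L\rightharpoonup G'$ and $r':G'\rightharpoonup G$ such that $(G,m,r')$ is a pushout of $r$ and $m'$. -}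

module Defs where

open import Data.Nat using (ℕ)
open import Data.Fin using (Fin)
open import Data.List using (List; length; map)
open import Data.Maybe using (Maybe; just; _>>=_)
open import Data.Product using (Σ; _×_; ∃)
open import Relation.Binary.PropositionalEquality using (_≡_)

record Sig : Set where
  field
    nLab : ℕ
    ar   : Fin nLab → ℕ

module _ (S : Sig) where
  open Sig S

  record Graph : Set where
    field
      nV  : ℕ
      nE  : ℕ
      lab : Fin nE → Fin nLab
      att : Fin nE → List (Fin nV)
      att-ar : ∀ e → length (att e) ≡ ar (lab e)
  open Graph public

  -- A (partial) morphism: pair of partial functions; whenever fE e is
  -- defined, fV is defined on all attached nodes of e, labels are
  -- preserved and fV (c(e)) = c'(fE e).
  record Morph (G H : Graph) : Set where
    field
      fV : Fin (nV G) → Maybe (Fin (nV H))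
      fE : Fin (nE G) → Maybe (Fin (nE H))
      lab-pres : ∀ e e' → fE e ≡ just e' → lab H e' ≡ lab G e
      att-pres : ∀ e e' → fE e ≡ just e' → map fV (att G e) ≡ map just (att H e')
  open Morph public

  _∘ᵖ_ : {A B C : Set} → (B → Maybe C) → (A → Maybe B) → A → Maybe C
  (g ∘ᵖ f) a = f a >>= g

  CompEq : {A B C : Graph} → Morph B C → Morph A B → Morph A C → Set
  CompEq g f h = (∀ v → (fV g ∘ᵖ fV f) v ≡ fV h v) × (∀ e → (fE g ∘ᵖ fE f) e ≡ fE h e)

  MorphEq : {A B : Graph} → Morph A B → Morph A B → Set
  MorphEq f g = (∀ v → fV f v ≡ fV g v) × (∀ e → fE f e ≡ fE g e)

  Commutes : {A B C D : Graph} → Morph B D → Morph A B → Morph C D → Morph A C → Set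
  Commutes g f k h = (∀ v → (fV g ∘ᵖ fV f) v ≡ (fV k ∘ᵖ fV h) v)
                   × (∀ e → (fE g ∘ᵖ fE f) e ≡ (fE k ∘ᵖ fE h) e)

  Total : {A B : Graph} → Morph A B → Set
  Total f = (∀ v → ∃ λ w → fV f v ≡ just w) × (∀ e → ∃ λ e' → fE f e ≡ just e')

  Injective : {A B : Graph} → Morph A B → Set
  Injective f = (∀ v v' w → fV f v ≡ just w → fV f v' ≡ just w → v ≡ v')
              × (∀ e e' d → fE f e ≡ just d → fE f e' ≡ just d → e ≡ e')

  Surjective : {A B : Graph} → Morph A B → Set
  Surjective f = (∀ w → ∃ λ v → fV f v ≡ just w) × (∀ d → ∃ λ e → fE f e ≡ just d)

  -- G₁ ⊑ G₂ iff there is a subgraph morphism (partial, injective, surjective) G₂ ⇀ G₁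
  _⊑_ : Graph → Graph → Set
  G₁ ⊑ G₂ = Σ (Morph G₂ G₁) λ f → Injective f × Surjective f

  _≅_ : Graph → Graph → Set
  G ≅ H = Σ (Morph G H) λ f → Σ (Morph H G) λ g →
            ((∀ v → (fV g ∘ᵖ fV f) v ≡ just v) × (∀ e → (fE g ∘ᵖ fE f) e ≡ just e))
          × ((∀ v → (fV f ∘ᵖ fV g) v ≡ just v) × (∀ e → (fE f ∘ᵖ fE g) e ≡ just e))

  record IsPushout {G₀ G₁ G₂ G₃ : Graph}
                   (φ : Morph G₀ G₁) (ψ : Morph G₀ G₂)
                   (ψ' : Morph G₁ G₃) (φ' : Morph G₂ G₃) : Set where
    field
      comm : Commutes ψ' φ φ' ψ
      universal : ∀ (H : Graph) (χ₁ : Morph G₁ H) (χ₂ : Morph G₂ H) →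
                  Commutes χ₁ φ χ₂ ψ →
                  Σ (Morph G₃ H) λ u → CompEq u ψ' χ₁ × CompEq u φ' χ₂ ×
                    (∀ (u' : Morph G₃ H) → CompEq u' ψ' χ₁ → CompEq u' φ' χ₂ → MorphEq u' u)

  record PushoutComplement {L R G : Graph} (r : Morph L R) (m : Morph R G) : Set where
    field
      G'  : Graph
      m'  : Morph L G'
      r'  : Morph G' G
      isPushout : IsPushout r m' m r'
  open PushoutComplement public

  record TIPC {L R G : Graph} (r : Morph L R) (m : Morph R G) : Set where
    field
      pc : PushoutComplement r m
      m'-total : Total (m' pc)
      m'-injective : Injective (m' pc)
  open TIPC public

  Minimal : {L R G : Graph} (r : Morph L R) (m : Morph R G) → TIPC r m → Set
  Minimal r m c = ∀ (d : TIPC r m) → G' (pc d) ⊑ G' (pc c) → G' (pc c) ⊑ G' (pc d)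

module Submission where

-- The pushout complements (K, m', r') of r : L ⇀ R and a total injective m : R → G with m'
-- total and injective have, up to isomorphism, finitely many minimal elements: exactly the
-- "tight" complements, whose components commute, are covered by the images of r' and m, and
-- send each context item (one outside the image of m') outside the image of m without sharing
-- its image.

open import Defs
open import Data.Empty using (⊥; ⊥-elim)
open import Data.Fin using (Fin; zero; suc; _↑ˡ_; _↑ʳ_; splitAt)
open import Data.Fin.Properties
  using (_≟_; any?; all?; injective⇒≤; ↑ˡ-injective; ↑ʳ-injective; splitAt-↑ˡ; splitAt-↑ʳ)
open import Data.List using (List; []; _∷_; map; length; concatMap; cartesianProduct; cartesianProductWith; allFin; upTo)
import Data.List.Properties as ListP
open import Data.List.Membership.Propositional using (_∈_; _∉_; lose)
open import Data.List.Membership.Propositional.Properties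
  using (∈-map⁺; ∈-allFin; ∈-upTo⁺; ∈-cartesianProductWith⁺; ∈-cartesianProduct⁺)
open import Data.List.Relation.Unary.All using (All; []; _∷_)
import Data.List.Relation.Unary.All as All
import Data.List.Relation.Unary.All.Properties as AllP
open import Data.List.Relation.Unary.Any using (Any; here; there)
import Data.List.Relation.Unary.Any as Any
import Data.List.Relation.Unary.Any.Properties as AnyP
open import Data.Maybe using (Maybe; just; nothing; _>>=_) renaming (map to mapᵐ)
open import Data.Maybe.Properties using (just-injective)
import Data.Maybe.Properties as MaybeP
open import Data.Nat using (ℕ; zero; suc; _≤_; _+_; s≤s)
open import Data.Nat.Properties using (≤-trans; 1+n≰n)
import Data.Nat.Properties as ℕP
open import Data.Product using (Σ; _×_; _,_; proj₁; proj₂; ∃)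
open import Data.Sum using (_⊎_; inj₁; inj₂; map₁)
open import Data.Vec using (Vec; tabulate; lookup)
import Data.Vec as Vec
open import Data.Vec.Properties using (lookup∘tabulate)
open import Relation.Nullary using (¬_; Dec; yes; no)
open import Relation.Nullary.Decidable using (_×-dec_; _⊎-dec_; _→-dec_; ¬?; map′)
open import Relation.Binary.PropositionalEquality

PMap : ℕ → ℕ → Set
PMap a b = Fin a → Maybe (Fin b)

InImage : ∀ {a b} → PMap a b → Fin b → Set
InImage f y = ∃ λ x → f x ≡ just y

TotalMap : ∀ {a b} → PMap a b → Set
TotalMap f = ∀ x → ∃ λ y → f x ≡ just y

InjectiveMap : ∀ {a b} → PMap a b → Set
InjectiveMap f = ∀ x x' y → f x ≡ just y → f x' ≡ just y → x ≡ x'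

SurjectiveMap : ∀ {a b} → PMap a b → Set
SurjectiveMap f = ∀ y → InImage f y

_≟ᵐ_ : ∀ {n} (p q : Maybe (Fin n)) → Dec (p ≡ q)
_≟ᵐ_ = MaybeP.≡-dec _≟_

inImage? : ∀ {a b} (f : PMap a b) (y : Fin b) → Dec (InImage f y)
inImage? f y = any? (λ x → f x ≟ᵐ just y)

defined? : ∀ {A : Set} (p : Maybe A) → Dec (∃ λ a → p ≡ just a)
defined? (just a) = yes (a , refl)
defined? nothing  = no λ ()

totalMap? : ∀ {a b} (f : PMap a b) → Dec (TotalMap f)
totalMap? f = all? λ x → any? λ y → f x ≟ᵐ just y

injectiveMap? : ∀ {a b} (f : PMap a b) → Dec (InjectiveMap f)
injectiveMap? f = all? λ x → all? λ x' → all? λ y → (f x ≟ᵐ just y) →-dec ((f x' ≟ᵐ just y) →-dec (x ≟ x'))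

just≢nothing : ∀ {A : Set} {a : A} → just a ≢ nothing
just≢nothing ()

>>=-just : ∀ {A B : Set} {p : Maybe A} {a : A} (f : A → Maybe B) → p ≡ just a → (p >>= f) ≡ f a
>>=-just f refl = refl

>>=-nothing : ∀ {A B : Set} {p : Maybe A} (f : A → Maybe B) → p ≡ nothing → (p >>= f) ≡ nothing
>>=-nothing f refl = refl

>>=-defined : ∀ {A B : Set} (p : Maybe A) (f : A → Maybe B) {b : B} →
              (p >>= f) ≡ just b → ∃ λ a → p ≡ just a × f a ≡ just b
>>=-defined (just a) f e = a , refl , e

>>=-cong : ∀ {A B : Set} {f g : A → Maybe B} → (∀ a → f a ≡ g a) → ∀ p → (p >>= f) ≡ (p >>= g)
>>=-cong f≗g (just a) = f≗g a
>>=-cong f≗g nothing  = refl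

>>=-return : ∀ {A : Set} (p : Maybe A) → (p >>= just) ≡ p
>>=-return (just _) = refl
>>=-return nothing  = refl

>>=-undefined : ∀ {A B : Set} (p : Maybe A) → (p >>= λ _ → nothing {A = B}) ≡ nothing
>>=-undefined (just _) = refl
>>=-undefined nothing  = refl

map-through : ∀ {A B C : Set} (f : A → Maybe B) (h : B → C) (k : A → C) →
              (∀ x y → f x ≡ just y → h y ≡ k x) →
              ∀ xs ys → map f xs ≡ map just ys → map h ys ≡ map k xs
map-through f h k agree [] [] _ = refl
map-through f h k agree (x ∷ xs) (y ∷ ys) e =
  cong₂ _∷_ (agree x y (proj₁ (ListP.∷-injective e)))
            (map-through f h k agree xs ys (proj₂ (ListP.∷-injective e)))

map-through-image : ∀ {A B : Set} (f : A → Maybe B) xs ys → map f xs ≡ map just ys →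
                    ∀ {y} → y ∈ ys → ∃ λ x → f x ≡ just y
map-through-image f (x ∷ xs) (y ∷ ys) e (here refl) = x , proj₁ (ListP.∷-injective e)
map-through-image f (x ∷ xs) (y ∷ ys) e (there p)   =
  map-through-image f xs ys (proj₂ (ListP.∷-injective e)) p

surjective⇒≤ : ∀ {a b} (f : PMap a b) → SurjectiveMap f → b ≤ a
surjective⇒≤ f surj = injective⇒≤ {f = λ y → proj₁ (surj y)} λ {y} {y'} e →
  just-injective (trans (sym (proj₂ (surj y))) (trans (cong f e) (proj₂ (surj y'))))

module Inverse {a b : ℕ} (f : PMap a b) (inj : InjectiveMap f) (surj : SurjectiveMap f) (a≤b : a ≤ b) where

  inverse : Fin b → Fin a
  inverse y = proj₁ (surj y)

  f∘inverse : ∀ y → f (inverse y) ≡ just y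
  f∘inverse y = proj₂ (surj y)

  inverse∘f : ∀ x y → f x ≡ just y → inverse y ≡ x
  inverse∘f x y e = inj (inverse y) x y (f∘inverse y) e

  -- If f were undefined at x, then x together with the preimages of all of Fin b would give
  -- b + 1 distinct elements of Fin a.
  total : TotalMap f
  total x with f x in fx
  ... | just y  = y , refl
  ... | nothing = ⊥-elim (1+n≰n (≤-trans (injective⇒≤ {f = extend} extend-injective) a≤b))
    where
      extend : Fin (suc b) → Fin a
      extend zero    = x
      extend (suc y) = inverse y

      undefined : ∀ y → inverse y ≢ x
      undefined y refl with () ← trans (sym (f∘inverse y)) fx

      extend-injective : ∀ {i j} → extend i ≡ extend j → i ≡ j
      extend-injective {zero}  {zero}  _ = refl
      extend-injective {zero}  {suc j} e = ⊥-elim (undefined j (sym e))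
      extend-injective {suc i} {zero}  e = ⊥-elim (undefined i e)
      extend-injective {suc i} {suc j} e =
        cong suc (just-injective (trans (sym (f∘inverse i)) (trans (cong f e) (f∘inverse j))))

  inverse-after : ∀ x → (f x >>= λ y → just (inverse y)) ≡ just x
  inverse-after x with total x
  ... | y , fx = trans (>>=-just (λ y → just (inverse y)) fx) (cong just (inverse∘f x y fx))

inverse-injective : ∀ {a b} (p : PMap a b) (q : PMap b a) → (∀ y → (q y >>= p) ≡ just y) → InjectiveMap q
inverse-injective p q p∘q y y' x qy qy' =
  just-injective (trans (sym (trans (sym (>>=-just p qy)) (p∘q y))) (trans (sym (>>=-just p qy')) (p∘q y')))

inverse-surjective : ∀ {a b} (p : PMap a b) (q : PMap b a) → (∀ x → (p x >>= q) ≡ just x) → SurjectiveMap q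
inverse-surjective p q q∘p x with >>=-defined (p x) q (q∘p x)
... | y , _ , qy = y , qy

module _ (S : Sig) where

  -- A subgraph morphism A ⇀ B into a graph with at least as many nodes and edges is an
  -- isomorphism; this is how size bounds turn ⊑ into ≅.
  subgraph-iso : ∀ {A B : Graph S} (f : Morph S A B) → Injective S f → Surjective S f →
                 nV A ≤ nV B → nE A ≤ nE B → _≅_ S A B
  subgraph-iso {A} {B} f (injV , injE) (surjV , surjE) V≤ E≤ =
    f , g , (IV.inverse-after , IE.inverse-after) , (IV.f∘inverse , IE.f∘inverse)
    where
      module IV = Inverse (fV f) injV surjV V≤
      module IE = Inverse (fE f) injE surjE E≤
      g : Morph S B A
      g = record
        { fV = λ w → just (IV.inverse w)
        ; fE = λ e → just (IE.inverse e)
        ; lab-pres = λ { e e' refl → sym (lab-pres f (IE.inverse e) e (IE.f∘inverse e)) }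
        ; att-pres = λ { e e' refl →
            map-through (fV f) (λ w → just (IV.inverse w)) just (λ x y fx → cong just (IV.inverse∘f x y fx))
                        (att A (IE.inverse e)) (att B e) (att-pres f (IE.inverse e) e (IE.f∘inverse e)) }
        }

  ≅⇒⊑ : ∀ {A B : Graph S} → _≅_ S A B → _⊑_ S A B
  ≅⇒⊑ (f , g , (gfV , gfE) , (fgV , fgE)) =
    g , (inverse-injective (fV f) (fV g) fgV , inverse-injective (fE f) (fE g) fgE)
      , (inverse-surjective (fV f) (fV g) gfV , inverse-surjective (fE f) (fE g) gfE)

Context : ∀ {a b} → PMap a b → Fin b → Set
Context m' k = ¬ InImage m' k

-- One component of a candidate square  L --r--> R --m--> G,  L --m'--> K --r'--> G
-- that is as small as a pushout complement can be: the square commutes, every context item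
-- of K survives in G outside the image of m and shares its image with no other item, and
-- G is covered by the images of r' and m.
record Tight {nL nR nG nK : ℕ} (m : PMap nR nG) (r : PMap nL nR) (m' : PMap nL nK) (r' : PMap nK nG) : Set where
  field
    commutes         : ∀ l → (r l >>= m) ≡ (m' l >>= r')
    context-outside  : ∀ k → Context m' k → ∃ λ g → r' k ≡ just g × ¬ InImage m g
    context-unshared : ∀ k k' g → Context m' k → r' k ≡ just g → r' k' ≡ just g → k' ≡ k
    covering         : ∀ g → InImage r' g ⊎ InImage m g

module _ {nL nR nG nK : ℕ} (m : PMap nR nG) (r : PMap nL nR) where

  tight? : (m' : PMap nL nK) (r' : PMap nK nG) → Dec (Tight m r m' r')
  tight? m' r' =
    map′ (λ (c , o , u , s) → record { commutes = c ; context-outside = o ; context-unshared = u ; covering = s })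
         (λ T → let open Tight T in commutes , context-outside , context-unshared , covering)
         (all? (λ l → (r l >>= m) ≟ᵐ (m' l >>= r'))
          ×-dec all? (λ k → ¬? (inImage? m' k) →-dec
                              any? (λ g → (r' k ≟ᵐ just g) ×-dec ¬? (inImage? m g)))
          ×-dec all? (λ k → all? (λ k' → all? (λ g → ¬? (inImage? m' k) →-dec
                              ((r' k ≟ᵐ just g) →-dec ((r' k' ≟ᵐ just g) →-dec (k' ≟ k))))))
          ×-dec all? (λ g → inImage? r' g ⊎-dec inImage? m g))

  tight-resp : {m₁ m₂ : PMap nL nK} {r₁ r₂ : PMap nK nG} →
               (∀ l → m₁ l ≡ m₂ l) → (∀ k → r₁ k ≡ r₂ k) → Tight m r m₁ r₁ → Tight m r m₂ r₂
  tight-resp {m₁} {m₂} {r₁} {r₂} m≗ r≗ T = record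
    { commutes         = λ l → trans (commutes l) (trans (cong (_>>= r₁) (m≗ l)) (>>=-cong r≗ (m₂ l)))
    ; context-outside  = λ k ck → let (g , rk , out) = context-outside k (context k ck) in
                                  g , trans (sym (r≗ k)) rk , out
    ; context-unshared = λ k k' g ck rk rk' →
                           context-unshared k k' g (context k ck) (trans (r≗ k) rk) (trans (r≗ k') rk')
    ; covering         = λ g → map₁ (λ (k , rk) → k , trans (sym (r≗ k)) rk) (covering g)
    }
    where
      open Tight T
      context : ∀ k → Context m₂ k → Context m₁ k
      context k ck (l , ml) = ck (l , trans (sym (m≗ l)) ml)

module Mediator {nL nR nG nK nH : ℕ} (m : PMap nR nG) (r : PMap nL nR) (m' : PMap nL nK) (r' : PMap nK nG)
                (m-total : TotalMap m) (m-injective : InjectiveMap m) (T : Tight m r m' r')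
                (χ₁ : PMap nR nH) (χ₂ : PMap nK nH) (cocone : ∀ l → (r l >>= χ₁) ≡ (m' l >>= χ₂)) where
  open Tight T

  mediate : ∀ {g} → Dec (InImage m g) → Dec (InImage r' g) → Maybe (Fin nH)
  mediate (yes (x , _)) _             = χ₁ x
  mediate (no _)        (yes (k , _)) = χ₂ k
  mediate (no _)        (no _)        = nothing

  mediator : PMap nG nH
  mediator g = mediate (inImage? m g) (inImage? r' g)

  mediator-m : ∀ x g → m x ≡ just g → mediator g ≡ χ₁ x
  mediator-m x g mx with inImage? m g
  ... | yes (x' , mx') = cong χ₁ (m-injective x' x g mx' mx)
  ... | no ¬img        = ⊥-elim (¬img (x , mx))

  mediator-context : ∀ k g → Context m' k → r' k ≡ just g → ¬ InImage m g → mediator g ≡ χ₂ k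
  mediator-context k g ck rk ¬img with inImage? m g
  ... | yes img = ⊥-elim (¬img img)
  ... | no _ with inImage? r' g
  ...   | yes (k' , rk') = cong χ₂ (context-unshared k k' g ck rk rk')
  ...   | no ¬img'       = ⊥-elim (¬img' (k , rk))

  mediator-cases : ∀ g h → mediator g ≡ just h →
                   (∃ λ x → m x ≡ just g × χ₁ x ≡ just h) ⊎ (∃ λ k → r' k ≡ just g × χ₂ k ≡ just h)
  mediator-cases g h e with inImage? m g
  ... | yes (x , mx) = inj₁ (x , mx , e)
  ... | no _ with inImage? r' g
  ...   | yes (k , rk) = inj₂ (k , rk , e)

  after-m : ∀ x → (m x >>= mediator) ≡ χ₁ x
  after-m x = let (g , mx) = m-total x in trans (>>=-just mediator mx) (mediator-m x g mx)

  -- On a context item this is the definition of the mediator; on an item m' l both sides are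
  -- computed through r l, by the commuting square and the cocone.
  after-r' : ∀ k → (r' k >>= mediator) ≡ χ₂ k
  after-r' k with inImage? m' k
  ... | no ck = let (g , rk , ¬img) = context-outside k ck in
                trans (>>=-just mediator rk) (mediator-context k g ck rk ¬img)
  ... | yes (l , m'l) with r l in rl
  ...   | just x = let (g , mx) = m-total x in begin
            (r' k >>= mediator) ≡⟨ cong (_>>= mediator) (r'k g mx) ⟩
            mediator g          ≡⟨ mediator-m x g mx ⟩
            χ₁ x                ≡⟨ sym (>>=-just χ₁ rl) ⟩
            (r l >>= χ₁)        ≡⟨ cocone l ⟩
            (m' l >>= χ₂)       ≡⟨ >>=-just χ₂ m'l ⟩
            χ₂ k                ∎
    where
      open ≡-Reasoning
      r'k : ∀ g → m x ≡ just g → r' k ≡ just g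
      r'k g mx = trans (sym (>>=-just r' m'l)) (trans (sym (commutes l)) (trans (>>=-just m rl) mx))
  ...   | nothing = begin
            (r' k >>= mediator) ≡⟨ cong (_>>= mediator) r'k ⟩
            nothing             ≡⟨ sym (>>=-nothing χ₁ rl) ⟩
            (r l >>= χ₁)        ≡⟨ cocone l ⟩
            (m' l >>= χ₂)       ≡⟨ >>=-just χ₂ m'l ⟩
            χ₂ k                ∎
    where
      open ≡-Reasoning
      r'k : r' k ≡ nothing
      r'k = trans (sym (>>=-just r' m'l)) (trans (sym (commutes l)) (>>=-nothing m rl))

  -- Since r' and m jointly cover G, a map is determined by its composites with them.
  unique : ∀ (u : PMap nG nH) → (∀ x → (m x >>= u) ≡ χ₁ x) → (∀ k → (r' k >>= u) ≡ χ₂ k) →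
           ∀ g → u g ≡ mediator g
  unique u u∘m u∘r' g with covering g
  ... | inj₁ (k , rk) = trans (sym (>>=-just u rk)) (trans (u∘r' k) (trans (sym (after-r' k)) (>>=-just mediator rk)))
  ... | inj₂ (x , mx) = trans (sym (>>=-just u mx)) (trans (u∘m x) (trans (sym (after-m x)) (>>=-just mediator mx)))

module _ (S : Sig) {L R G : Graph S} (r : Morph S L R) (m : Morph S R G)
         (m-total : Total S m) (m-injective : Injective S m) where

  module MediatingMorphism {K : Graph S} (m' : Morph S L K) (r' : Morph S K G)
                           (TV : Tight (fV m) (fV r) (fV m') (fV r')) (TE : Tight (fE m) (fE r) (fE m') (fE r'))
                           {H : Graph S} (χ₁ : Morph S R H) (χ₂ : Morph S K H) (cocone : Commutes S χ₁ r χ₂ m') where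
    module MV = Mediator (fV m) (fV r) (fV m') (fV r') (proj₁ m-total) (proj₁ m-injective) TV
                         (fV χ₁) (fV χ₂) (proj₁ cocone)
    module ME = Mediator (fE m) (fE r) (fE m') (fE r') (proj₂ m-total) (proj₂ m-injective) TE
                         (fE χ₁) (fE χ₂) (proj₂ cocone)

    -- An edge of G is reached through m or through r', and both preserve labels and attachments.
    lab-preserved : ∀ g h → ME.mediator g ≡ just h → lab H h ≡ lab G g
    lab-preserved g h e with ME.mediator-cases g h e
    ... | inj₁ (x , mx , χx) = trans (lab-pres χ₁ x h χx) (sym (lab-pres m x g mx))
    ... | inj₂ (k , rk , χk) = trans (lab-pres χ₂ k h χk) (sym (lab-pres r' k g rk))

    att-preserved : ∀ g h → ME.mediator g ≡ just h → map MV.mediator (att G g) ≡ map just (att H h)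
    att-preserved g h e with ME.mediator-cases g h e
    ... | inj₁ (x , mx , χx) =
      trans (map-through (fV m) MV.mediator (fV χ₁) MV.mediator-m (att R x) (att G g) (att-pres m x g mx))
            (att-pres χ₁ x h χx)
    ... | inj₂ (k , rk , χk) =
      trans (map-through (fV r') MV.mediator (fV χ₂) (λ a b rab → trans (sym (>>=-just MV.mediator rab)) (MV.after-r' a))
                         (att K k) (att G g) (att-pres r' k g rk))
            (att-pres χ₂ k h χk)

    mediating : Morph S G H
    mediating = record { fV = MV.mediator ; fE = ME.mediator ; lab-pres = lab-preserved ; att-pres = att-preserved }

  tight⇒pushout : {K : Graph S} (m' : Morph S L K) (r' : Morph S K G) →
                  Tight (fV m) (fV r) (fV m') (fV r') → Tight (fE m) (fE r) (fE m') (fE r') →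
                  IsPushout S r m' m r'
  tight⇒pushout m' r' TV TE = record
    { comm      = Tight.commutes TV , Tight.commutes TE
    ; universal = λ H χ₁ χ₂ cocone → let open MediatingMorphism m' r' TV TE χ₁ χ₂ cocone in
        mediating , (MV.after-m , ME.after-m) , (MV.after-r' , ME.after-r')
                  , λ u (u∘mV , u∘mE) (u∘r'V , u∘r'E) →
                      MV.unique (fV u) u∘mV u∘r'V , ME.unique (fE u) u∘mE u∘r'E
    }

removeAt : ∀ {a b} → Fin a → PMap a b → PMap a b
removeAt y f k with k ≟ y
... | yes _ = nothing
... | no _  = f k

removeAt-here : ∀ {a b} (y : Fin a) (f : PMap a b) → removeAt y f y ≡ nothing
removeAt-here y f with y ≟ y
... | yes _  = refl
... | no y≢y = ⊥-elim (y≢y refl)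

removeAt-there : ∀ {a b} (y : Fin a) (f : PMap a b) k → k ≢ y → removeAt y f k ≡ f k
removeAt-there y f k k≢y with k ≟ y
... | yes k≡y = ⊥-elim (k≢y k≡y)
... | no _    = refl

removeAt-just : ∀ {a b} (y : Fin a) (f : PMap a b) k {z} → removeAt y f k ≡ just z → f k ≡ just z
removeAt-just y f k e with k ≟ y
... | no _ = e

keepIf : ∀ {P A : Set} → Dec P → A → Maybe A
keepIf (yes _) a = just a
keepIf (no _)  a = nothing

keepIf-just : ∀ {P A : Set} (d : Dec P) {a b : A} → keepIf d a ≡ just b → P × a ≡ b
keepIf-just (yes p) refl = p , refl

keepIf-yes : ∀ {P A : Set} (d : Dec P) {a : A} → P → keepIf d a ≡ just a
keepIf-yes (yes _) _ = refl
keepIf-yes (no ¬p) p = ⊥-elim (¬p p)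

covered-part : ∀ {a b c} → PMap a c → PMap b c → PMap c c
covered-part f g y = keepIf (inImage? f y ⊎-dec inImage? g y) y

covered-part-left : ∀ {a b c} (f : PMap a c) (g : PMap b c) x → (f x >>= covered-part f g) ≡ f x
covered-part-left f g x with f x in fx
... | just y  = keepIf-yes (inImage? f y ⊎-dec inImage? g y) (inj₁ (x , fx))
... | nothing = refl

covered-part-right : ∀ {a b c} (f : PMap a c) (g : PMap b c) x → (g x >>= covered-part f g) ≡ g x
covered-part-right f g x with g x in gx
... | just y  = keepIf-yes (inImage? f y ⊎-dec inImage? g y) (inj₂ (x , gx))
... | nothing = refl

covered-part-total : ∀ {a b c} (f : PMap a c) (g : PMap b c) →
                     (∀ y → covered-part f g y ≡ just y) → ∀ y → InImage f y ⊎ InImage g y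
covered-part-total f g total y = proj₁ (keepIf-just (inImage? f y ⊎-dec inImage? g y) (total y))

-- The key consequence of uniqueness in a pushout G of r and m': a mediating u : G ⇀ G with
-- u ∘ m = m and u ∘ r' = r' without y shows that r'(y) is not in the image of m and is
-- shared by no other item.
module Separation {nR nG nK : ℕ} (m : PMap nR nG) (r' : PMap nK nG) (y : Fin nK) (u : PMap nG nG)
                  (u∘m : ∀ x → (m x >>= u) ≡ m x) (u∘r' : ∀ k → (r' k >>= u) ≡ removeAt y r' k) where

  u-undefined : ∀ g → r' y ≡ just g → u g ≡ nothing
  u-undefined g ry = trans (sym (>>=-just u ry)) (trans (u∘r' y) (removeAt-here y r'))

  outside : ∀ g → r' y ≡ just g → ¬ InImage m g
  outside g ry (x , mx) = just≢nothing (trans (sym (trans (sym (>>=-just u mx)) (trans (u∘m x) mx))) (u-undefined g ry))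

  unshared : ∀ k g → r' y ≡ just g → r' k ≡ just g → k ≡ y
  unshared k g ry rk with k ≟ y
  ... | yes k≡y = k≡y
  ... | no k≢y = ⊥-elim (just≢nothing (sym (trans (sym (u-undefined g ry))
                          (trans (sym (>>=-just u rk)) (trans (u∘r' k) (trans (removeAt-there y r' k k≢y) rk))))))

agree-commutes : ∀ {nL nR nG nK : ℕ} (m : PMap nR nG) (r : PMap nL nR) (m' : PMap nL nK) (r' χ : PMap nK nG) →
                 TotalMap m' → (∀ l → (r l >>= m) ≡ (m' l >>= r')) →
                 (∀ l k → m' l ≡ just k → χ k ≡ r' k) → ∀ l → (r l >>= m) ≡ (m' l >>= χ)
agree-commutes m r m' r' χ m'-total commutes agree l =
  let (k , m'l) = m'-total l in
  trans (commutes l) (trans (>>=-just r' m'l) (trans (sym (agree l k m'l)) (sym (>>=-just χ m'l))))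

module _ (S : Sig) where

  -- The single-node graph, used to probe whether a node survives in a pushout.
  Point : Graph S
  Point = record { nV = 1 ; nE = 0 ; lab = λ () ; att = λ () ; att-ar = λ () }

  identity : (A : Graph S) → Morph S A A
  identity A = record { fV = just ; fE = just ; lab-pres = λ { e .e refl → refl } ; att-pres = λ { e .e refl → refl } }

  coveredPart : ∀ {X Y A : Graph S} (h₁ : Morph S X A) (h₂ : Morph S Y A) → Morph S A A
  coveredPart {X} {Y} {A} h₁ h₂ = record
    { fV = covered-part (fV h₁) (fV h₂)
    ; fE = covered-part (fE h₁) (fE h₂)
    ; lab-pres = λ e e' eq → cong (lab A) (sym (proj₂ (keepIf-just (inImage? (fE h₁) e ⊎-dec inImage? (fE h₂) e) eq)))
    ; att-pres = λ e e' eq → covered-att e e' (keepIf-just (inImage? (fE h₁) e ⊎-dec inImage? (fE h₂) e) eq)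
    }
    where
      cpV : PMap (nV A) (nV A)
      cpV = covered-part (fV h₁) (fV h₂)

      -- An edge in the image of h has all its nodes in the image of h, where cpV is the identity.
      fixed-by : ∀ {Z : Graph S} (h : Morph S Z A) → (∀ z a → fV h z ≡ just a → cpV a ≡ just a) →
                 ∀ z e → fE h z ≡ just e → map cpV (att A e) ≡ map just (att A e)
      fixed-by {Z} h fixes z e hz =
        trans (map-through (fV h) cpV (fV h) (λ x a hx → trans (fixes x a hx) (sym hx))
                           (att Z z) (att A e) (att-pres h z e hz))
              (att-pres h z e hz)

      covered-att : ∀ e e' → (InImage (fE h₁) e ⊎ InImage (fE h₂) e) × e ≡ e' →
                    map cpV (att A e) ≡ map just (att A e')
      covered-att e .e (inj₁ (z , hz) , refl) =
        fixed-by h₁ (λ x a hx → keepIf-yes (inImage? (fV h₁) a ⊎-dec inImage? (fV h₂) a) (inj₁ (x , hx))) z e hz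
      covered-att e .e (inj₂ (z , hz) , refl) =
        fixed-by h₂ (λ x a hx → keepIf-yes (inImage? (fV h₁) a ⊎-dec inImage? (fV h₂) a) (inj₂ (x , hx))) z e hz

module ComplementFacts (S : Sig) {L R G : Graph S} (r : Morph S L R) (m : Morph S R G)
                       {K : Graph S} (m' : Morph S L K) (r' : Morph S K G)
                       (PO : IsPushout S r m' m r') (m'-total : Total S m') where
  open IsPushout PO

  -- Endomorphisms of G fixing m and r' agree: both are the mediating morphism of (m, r').
  fixing-unique : (u₁ u₂ : Morph S G G) → CompEq S u₁ m m → CompEq S u₁ r' r' →
                  CompEq S u₂ m m → CompEq S u₂ r' r' → MorphEq S u₁ u₂
  fixing-unique u₁ u₂ u₁∘m u₁∘r' u₂∘m u₂∘r' =
    let (_ , _ , _ , unique) = universal G m r' comm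
        (u₁V , u₁E) = unique u₁ u₁∘m u₁∘r'
        (u₂V , u₂E) = unique u₂ u₂∘m u₂∘r'
    in (λ v → trans (u₁V v) (sym (u₂V v))) , (λ e → trans (u₁E e) (sym (u₂E e)))

  -- The images of r' and m cover G, since the partial identity on the covered part fixes
  -- both and hence is the identity.
  covering : (∀ g → InImage (fV r') g ⊎ InImage (fV m) g) × (∀ g → InImage (fE r') g ⊎ InImage (fE m) g)
  covering = covered-part-total (fV r') (fV m) (proj₁ covered≈id) , covered-part-total (fE r') (fE m) (proj₂ covered≈id)
    where
      covered≈id : MorphEq S (coveredPart S r' m) (identity S G)
      covered≈id = fixing-unique (coveredPart S r' m) (identity S G)
        (covered-part-right (fV r') (fV m) , covered-part-right (fE r') (fE m))
        (covered-part-left (fV r') (fV m) , covered-part-left (fE r') (fE m))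
        ((λ x → >>=-return (fV m x)) , (λ x → >>=-return (fE m x)))
        ((λ k → >>=-return (fV r' k)) , (λ k → >>=-return (fE r' k)))

  record Endomediator (χ : Morph S K G) : Set where
    field
      u    : Morph S G G
      u∘m  : CompEq S u m m
      u∘r' : CompEq S u r' χ

  endomediator : (χ : Morph S K G) → Commutes S m r χ m' → Endomediator χ
  endomediator χ cocone = let (u , u∘m , u∘r' , _) = universal G m χ cocone in
    record { u = u ; u∘m = u∘m ; u∘r' = u∘r' }

  -- A context node survives in G: otherwise the cocone into the one-node graph that sees only
  -- this node would have no mediating map.
  context-node-survives : ∀ y → Context (fV m') y → ∃ λ g → fV r' y ≡ just g
  context-node-survives y cy with fV r' y in ry
  ... | just g  = g , refl
  ... | nothing = ⊥-elim (unseen ry)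
    where
      χ₁ : Morph S R (Point S)
      χ₁ = record { fV = λ _ → nothing ; fE = λ _ → nothing ; lab-pres = λ _ _ () ; att-pres = λ _ _ () }
      χ₂ : Morph S K (Point S)
      χ₂ = record { fV = λ k → keepIf (k ≟ y) zero ; fE = λ _ → nothing ; lab-pres = λ _ _ () ; att-pres = λ _ _ () }

      χ₂-off-image : ∀ l k → fV m' l ≡ just k → keepIf (k ≟ y) zero ≡ nothing
      χ₂-off-image l k m'l with k ≟ y
      ... | yes refl = ⊥-elim (cy (l , m'l))
      ... | no _     = refl

      cocone : Commutes S χ₁ r χ₂ m'
      cocone = (λ l → let (k , m'l) = proj₁ m'-total l in
                      trans (>>=-undefined (fV r l)) (sym (trans (>>=-just (fV χ₂) m'l) (χ₂-off-image l k m'l))))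
             , (λ l → trans (>>=-undefined (fE r l)) (sym (>>=-undefined (fE m' l))))

      -- The mediating u satisfies u ∘ r' = χ₂, which is defined at y; so r' is defined at y.
      unseen : fV r' y ≡ nothing → ⊥
      unseen ry = let (u , _ , (u∘r'V , _) , _) = universal (Point S) χ₁ χ₂ cocone in
        just≢nothing (trans (sym (keepIf-yes (y ≟ y) refl)) (trans (sym (u∘r'V y)) (>>=-nothing (fV u) ry)))

  module NodeRemoval (y : Fin (nV K)) (cy : Context (fV m') y) where

    dropAttached : PMap (nE K) (nE G)
    dropAttached e with Any.any? (y ≟_) (att K e)
    ... | yes _ = nothing
    ... | no _  = fE r' e

    dropAttached-just : ∀ e e' → dropAttached e ≡ just e' → y ∉ att K e × fE r' e ≡ just e'
    dropAttached-just e e' eq with Any.any? (y ≟_) (att K e)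
    ... | no y∉ = y∉ , eq

    dropAttached-image : ∀ l e → fE m' l ≡ just e → dropAttached e ≡ fE r' e
    dropAttached-image l e m'l with Any.any? (y ≟_) (att K e)
    ... | yes y∈ = ⊥-elim (cy (map-through-image (fV m') (att L l) (att K e) (att-pres m' l e m'l) y∈))
    ... | no _   = refl

    without-y : Morph S K G
    without-y = record
      { fV = removeAt y (fV r')
      ; fE = dropAttached
      ; lab-pres = λ e e' eq → lab-pres r' e e' (proj₂ (dropAttached-just e e' eq))
      ; att-pres = λ e e' eq → let (y∉ , re) = dropAttached-just e e' eq in
          trans (ListP.map-cong-local (All.tabulate λ {v} v∈ → removeAt-there y (fV r') v λ { refl → y∉ v∈ }))
                (att-pres r' e e' re)
      }

    cocone : Commutes S m r without-y m'
    cocone = agree-commutes (fV m) (fV r) (fV m') (fV r') (removeAt y (fV r')) (proj₁ m'-total) (proj₁ comm)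
                            (λ l k m'l → removeAt-there y (fV r') k λ { refl → cy (l , m'l) })
           , agree-commutes (fE m) (fE r) (fE m') (fE r') dropAttached (proj₂ m'-total) (proj₂ comm) dropAttached-image

    open Endomediator (endomediator without-y cocone)
    open Separation (fV m) (fV r') y (fV u) (proj₁ u∘m) (proj₁ u∘r') public using (outside; unshared)

  module EdgeRemoval (y : Fin (nE K)) (cy : Context (fE m') y) where

    without-y : Morph S K G
    without-y = record
      { fV = fV r'
      ; fE = removeAt y (fE r')
      ; lab-pres = λ e e' eq → lab-pres r' e e' (removeAt-just y (fE r') e eq)
      ; att-pres = λ e e' eq → att-pres r' e e' (removeAt-just y (fE r') e eq)
      }

    cocone : Commutes S m r without-y m'
    cocone = proj₁ comm
           , agree-commutes (fE m) (fE r) (fE m') (fE r') (removeAt y (fE r')) (proj₂ m'-total) (proj₂ comm)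
                            (λ l k m'l → removeAt-there y (fE r') k λ { refl → cy (l , m'l) })

    open Endomediator (endomediator without-y cocone)
    open Separation (fE m) (fE r') y (fE u) (proj₂ u∘m) (proj₂ u∘r') public using (outside; unshared)

  nodes-tight : Tight (fV m) (fV r) (fV m') (fV r')
  nodes-tight = record
    { commutes         = proj₁ comm
    ; context-outside  = λ k ck → let (g , rk) = context-node-survives k ck in g , rk , NodeRemoval.outside k ck g rk
    ; context-unshared = λ k k' g ck rk rk' → NodeRemoval.unshared k ck k' g rk rk'
    ; covering         = proj₁ covering
    }

  edge-context-outside : ∀ y → Context (fE m') y → ∀ g → fE r' y ≡ just g → ¬ InImage (fE m) g
  edge-context-outside y cy = EdgeRemoval.outside y cy

  edge-context-unshared : ∀ y → Context (fE m') y → ∀ k g → fE r' y ≡ just g → fE r' k ≡ just g → k ≡ y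
  edge-context-unshared y cy = EdgeRemoval.unshared y cy

module TightSize {nL nR nG nD : ℕ} {m : PMap nR nG} {r : PMap nL nR} {m' : PMap nL nD} {r' : PMap nD nG}
                 (T : Tight m r m' r') where
  open Tight T

  -- An item of D either comes from L or is a context item, determined by its image in G,
  -- which lies outside the image of m.  Hence D injects into any set that receives L (via α)
  -- and the part of G outside m (via β) disjointly.
  embeds : ∀ {n} (α : Fin nL → Fin n) (β : ∀ g → ¬ InImage m g → Fin n) →
           (∀ l l' → α l ≡ α l' → m' l ≡ m' l') → (∀ g g' out out' → β g out ≡ β g' out' → g ≡ g') →
           (∀ l g out → α l ≢ β g out) → nD ≤ n
  embeds {n} α β α-inj β-inj disjoint =
    injective⇒≤ {f = λ k → place k (inImage? m' k)} λ {k} {k'} → place-injective k k' (inImage? m' k) (inImage? m' k')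
    where
      place : ∀ k → Dec (InImage m' k) → Fin n
      place k (yes (l , _)) = α l
      place k (no ck)       = β (proj₁ (context-outside k ck)) (proj₂ (proj₂ (context-outside k ck)))

      place-injective : ∀ k k' d d' → place k d ≡ place k' d' → k ≡ k'
      place-injective k k' (yes (l , m'l)) (yes (l' , m'l')) e = just-injective (trans (sym m'l) (trans (α-inj l l' e) m'l'))
      place-injective k k' (yes (l , _))   (no ck')          e = ⊥-elim (disjoint l _ _ e)
      place-injective k k' (no ck)         (yes (l' , _))    e = ⊥-elim (disjoint l' _ _ (sym e))
      place-injective k k' (no ck)         (no ck')          e with context-outside k ck | context-outside k' ck'
      ... | g , rk , out | g' , rk' , out' =
        sym (context-unshared k k' g ck rk (trans rk' (cong just (sym (β-inj g g' out out' e)))))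

  bounded : nD ≤ nL + nG
  bounded = embeds (_↑ˡ nG) (λ g _ → nL ↑ʳ g)
                   (λ l l' e → cong m' (↑ˡ-injective nG l l' e)) (λ g g' _ _ → ↑ʳ-injective nL g g')
                   (λ l g _ e → inj₁≢inj₂ (trans (sym (splitAt-↑ˡ nL l nG))
                                                (trans (cong (splitAt nL) e) (splitAt-↑ʳ nL nG g))))
    where
      inj₁≢inj₂ : ∀ {A B : Set} {a : A} {b : B} → inj₁ a ≢ inj₂ b
      inj₁≢inj₂ ()

  below : ∀ {nC} (m'C : PMap nL nC) (r'C : PMap nC nG) → TotalMap m'C → InjectiveMap m'C →
          (∀ l → (r l >>= m) ≡ (m'C l >>= r'C)) → (∀ g → InImage r'C g ⊎ InImage m g) → nD ≤ nC
  below {nC} m'C r'C m'C-total m'C-injective commutesC coveringC = embeds α β α-inj β-inj disjoint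
    where
      α : Fin nL → Fin nC
      α l = proj₁ (m'C-total l)

      preimage : ∀ g → ¬ InImage m g → InImage r'C g
      preimage g out with coveringC g
      ... | inj₁ img = img
      ... | inj₂ img = ⊥-elim (out img)

      β : ∀ g → ¬ InImage m g → Fin nC
      β g out = proj₁ (preimage g out)

      α-inj : ∀ l l' → α l ≡ α l' → m' l ≡ m' l'
      α-inj l l' e = cong m' (m'C-injective l l' _ (proj₂ (m'C-total l)) (trans (proj₂ (m'C-total l')) (cong just (sym e))))

      β-inj : ∀ g g' out out' → β g out ≡ β g' out' → g ≡ g'
      β-inj g g' out out' e =
        just-injective (trans (sym (proj₂ (preimage g out))) (trans (cong r'C e) (proj₂ (preimage g' out'))))

      -- r'_C (m'_C l) = m (r l) lies in the image of m.
      disjoint : ∀ l g out → α l ≢ β g out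
      disjoint l g out e =
        let r'αl = trans (cong r'C e) (proj₂ (preimage g out))
            (x , _ , mx) = >>=-defined (r l) m (trans (commutesC l) (trans (>>=-just r'C (proj₂ (m'C-total l))) r'αl))
        in out (x , mx)

module _ (S : Sig) {L R G : Graph S} {r : Morph S L R} {m : Morph S R G} where

  -- A complement with tight components is minimal: every complement below it is at least as
  -- large, so the subgraph morphism witnessing this is an isomorphism.
  tight-minimal : (c : TIPC S r m) →
                  Tight (fV m) (fV r) (fV (m' (pc c))) (fV (r' (pc c))) →
                  Tight (fE m) (fE r) (fE (m' (pc c))) (fE (r' (pc c))) → Minimal S r m c
  tight-minimal c TV TE d (f , f-injective , f-surjective) =
    ≅⇒⊑ S (subgraph-iso S f f-injective f-surjective
             (TightSize.below TV (fV (m' D)) (fV (r' D)) (proj₁ (m'-total d)) (proj₁ (m'-injective d))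
                              (proj₁ (IsPushout.comm (isPushout D))) (proj₁ covering))
             (TightSize.below TE (fE (m' D)) (fE (r' D)) (proj₂ (m'-total d)) (proj₂ (m'-injective d))
                              (proj₂ (IsPushout.comm (isPushout D))) (proj₂ covering)))
    where
      D : PushoutComplement S r m
      D = pc d
      open ComplementFacts S r m (m' D) (r' D) (isPushout D) (m'-total d) using (covering)

  minimal-absorbs : (c : TIPC S r m) → Minimal S r m c → (d : TIPC S r m) →
                    _⊑_ S (G' (pc d)) (G' (pc c)) → _≅_ S (G' (pc c)) (G' (pc d))
  minimal-absorbs c minimal d d⊑c@(σ , σ-injective , σ-surjective) =
    let (back , _ , (backV-surjective , backE-surjective)) = minimal d d⊑c in
    subgraph-iso S σ σ-injective σ-surjective
      (surjective⇒≤ (fV back) backV-surjective) (surjective⇒≤ (fE back) backE-surjective)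

record Reindexing (n : ℕ) (P : Fin n → Set) : Set where
  field
    size        : ℕ
    embed       : Fin size → Fin n
    embed-P     : ∀ i → P (embed i)
    index       : PMap n size
    index-embed : ∀ i → index (embed i) ≡ just i
    embed-index : ∀ e i → index e ≡ just i → embed i ≡ e
    index-P     : ∀ e → P e → ∃ λ i → index e ≡ just i

  embed-injective : ∀ i j → embed i ≡ embed j → i ≡ j
  embed-injective i j e = just-injective (trans (sym (index-embed i)) (trans (cong index e) (index-embed j)))

reindex : ∀ n (P : Fin n → Set) → (∀ e → Dec (P e)) → Reindexing n P
reindex zero P P? = record
  { size = 0 ; embed = λ () ; embed-P = λ () ; index = λ () ; index-embed = λ () ; embed-index = λ () ; index-P = λ () }
reindex (suc n) P P? = extend (P? zero) (reindex n (λ e → P (suc e)) (λ e → P? (suc e)))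
  where
    extend : Dec (P zero) → Reindexing n (λ e → P (suc e)) → Reindexing (suc n) P
    extend (yes p₀) ρ = record
      { size = suc size ; embed = embed′ ; embed-P = embed′-P ; index = index′
      ; index-embed = index′-embed ; embed-index = embed′-index ; index-P = index′-P }
      where
        open Reindexing ρ
        embed′ : Fin (suc size) → Fin (suc n)
        embed′ zero    = zero
        embed′ (suc i) = suc (embed i)
        embed′-P : ∀ i → P (embed′ i)
        embed′-P zero    = p₀
        embed′-P (suc i) = embed-P i
        index′ : PMap (suc n) (suc size)
        index′ zero    = just zero
        index′ (suc e) = mapᵐ suc (index e)
        index′-embed : ∀ i → index′ (embed′ i) ≡ just i
        index′-embed zero    = refl
        index′-embed (suc i) = cong (mapᵐ suc) (index-embed i)
        embed′-index : ∀ e i → index′ e ≡ just i → embed′ i ≡ e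
        embed′-index zero    .zero refl = refl
        embed′-index (suc e) i eq with index e in ie
        embed′-index (suc e) .(suc j) refl | just j = cong suc (embed-index e j ie)
        index′-P : ∀ e → P e → ∃ λ i → index′ e ≡ just i
        index′-P zero    _ = zero , refl
        index′-P (suc e) p = let (i , ie) = index-P e p in suc i , MaybeP.map-just ie
    extend (no ¬p₀) ρ = record
      { size = size ; embed = λ i → suc (embed i) ; embed-P = embed-P ; index = index′
      ; index-embed = index-embed ; embed-index = embed′-index ; index-P = index′-P }
      where
        open Reindexing ρ
        index′ : PMap (suc n) size
        index′ zero    = nothing
        index′ (suc e) = index e
        embed′-index : ∀ e i → index′ e ≡ just i → suc (embed i) ≡ e
        embed′-index (suc e) i eq = cong suc (embed-index e i eq)
        index′-P : ∀ e → P e → ∃ λ i → index′ e ≡ just i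
        index′-P zero    p = ⊥-elim (¬p₀ p)
        index′-P (suc e) p = index-P e p

module Candidates (S : Sig) {L R G : Graph S} (r : Morph S L R) (m : Morph S R G)
                  (m-total : Total S m) (m-injective : Injective S m) where
  open Sig S

  record Candidate (N M : ℕ) : Set where
    field
      labels : Fin M → Fin nLab
      attach : Fin M → List (Fin N)
      m'V    : PMap (nV L) N
      m'E    : PMap (nE L) M
      r'V    : PMap N (nV G)
      r'E    : PMap M (nE G)
  open Candidate public

  _≐_ : ∀ {N M} → Candidate N M → Candidate N M → Set
  d ≐ c = (∀ e → labels d e ≡ labels c e) × (∀ e → attach d e ≡ attach c e)
        × (∀ v → m'V d v ≡ m'V c v) × (∀ e → m'E d e ≡ m'E c e)
        × (∀ v → r'V d v ≡ r'V c v) × (∀ e → r'E d e ≡ r'E c e)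

  record Valid {N M : ℕ} (c : Candidate N M) : Set where
    field
      arity         : ∀ e → length (attach c e) ≡ ar (labels c e)
      m'-lab        : ∀ l e → m'E c l ≡ just e → labels c e ≡ lab L l
      m'-att        : ∀ l e → m'E c l ≡ just e → map (m'V c) (att L l) ≡ map just (attach c e)
      r'-lab        : ∀ e g → r'E c e ≡ just g → lab G g ≡ labels c e
      r'-att        : ∀ e g → r'E c e ≡ just g → map (r'V c) (attach c e) ≡ map just (att G g)
      m'V-total     : TotalMap (m'V c)
      m'E-total     : TotalMap (m'E c)
      m'V-injective : InjectiveMap (m'V c)
      m'E-injective : InjectiveMap (m'E c)
      nodes-tight   : Tight (fV m) (fV r) (m'V c) (r'V c)
      edges-tight   : Tight (fE m) (fE r) (m'E c) (r'E c)

  valid? : ∀ {N M} (c : Candidate N M) → Dec (Valid c)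
  valid? c =
    map′ (λ (a , b , c , d , e , f , g , h , i , j , k) → record
           { arity = a ; m'-lab = b ; m'-att = c ; r'-lab = d ; r'-att = e ; m'V-total = f ; m'E-total = g
           ; m'V-injective = h ; m'E-injective = i ; nodes-tight = j ; edges-tight = k })
         (λ v → let open Valid v in
           arity , m'-lab , m'-att , r'-lab , r'-att , m'V-total , m'E-total , m'V-injective , m'E-injective
                 , nodes-tight , edges-tight)
         (all? (λ e → length (attach c e) ℕP.≟ ar (labels c e))
          ×-dec all? (λ l → all? λ e → (m'E c l ≟ᵐ just e) →-dec (labels c e ≟ lab L l))
          ×-dec all? (λ l → all? λ e → (m'E c l ≟ᵐ just e) →-dec
                                         ListP.≡-dec _≟ᵐ_ (map (m'V c) (att L l)) (map just (attach c e)))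
          ×-dec all? (λ e → all? λ g → (r'E c e ≟ᵐ just g) →-dec (lab G g ≟ labels c e))
          ×-dec all? (λ e → all? λ g → (r'E c e ≟ᵐ just g) →-dec
                                         ListP.≡-dec _≟ᵐ_ (map (r'V c) (attach c e)) (map just (att G g)))
          ×-dec totalMap? (m'V c) ×-dec totalMap? (m'E c)
          ×-dec injectiveMap? (m'V c) ×-dec injectiveMap? (m'E c)
          ×-dec tight? (fV m) (fV r) (m'V c) (r'V c) ×-dec tight? (fE m) (fE r) (m'E c) (r'E c))

  valid-resp : ∀ {N M} {d c : Candidate N M} → d ≐ c → Valid c → Valid d
  valid-resp {d = d} {c} (lab≗ , att≗ , m'V≗ , m'E≗ , r'V≗ , r'E≗) v = record
    { arity         = λ e → trans (cong length (att≗ e)) (trans (arity e) (cong ar (sym (lab≗ e))))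
    ; m'-lab        = λ l e eq → trans (lab≗ e) (m'-lab l e (trans (sym (m'E≗ l)) eq))
    ; m'-att        = λ l e eq → trans (ListP.map-cong m'V≗ (att L l))
                                   (trans (m'-att l e (trans (sym (m'E≗ l)) eq)) (cong (map just) (sym (att≗ e))))
    ; r'-lab        = λ e g eq → trans (r'-lab e g (trans (sym (r'E≗ e)) eq)) (sym (lab≗ e))
    ; r'-att        = λ e g eq → trans (cong (map (r'V d)) (att≗ e))
                                   (trans (ListP.map-cong r'V≗ (attach c e)) (r'-att e g (trans (sym (r'E≗ e)) eq)))
    ; m'V-total     = λ x → let (y , e) = m'V-total x in y , trans (m'V≗ x) e
    ; m'E-total     = λ x → let (y , e) = m'E-total x in y , trans (m'E≗ x) e
    ; m'V-injective = λ x x' y e e' → m'V-injective x x' y (trans (sym (m'V≗ x)) e) (trans (sym (m'V≗ x')) e')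
    ; m'E-injective = λ x x' y e e' → m'E-injective x x' y (trans (sym (m'E≗ x)) e) (trans (sym (m'E≗ x')) e')
    ; nodes-tight   = tight-resp (fV m) (fV r) (λ l → sym (m'V≗ l)) (λ k → sym (r'V≗ k)) nodes-tight
    ; edges-tight   = tight-resp (fE m) (fE r) (λ l → sym (m'E≗ l)) (λ k → sym (r'E≗ k)) edges-tight
    }
    where open Valid v

  module Complement {N M : ℕ} {c : Candidate N M} (v : Valid c) where
    open Valid v

    graph : Graph S
    graph = record { nV = N ; nE = M ; lab = labels c ; att = attach c ; att-ar = arity }

    complement : TIPC S r m
    complement = record
      { pc = record { G' = graph ; m' = m'-morph ; r' = r'-morph
                    ; isPushout = tight⇒pushout S r m m-total m-injective m'-morph r'-morph nodes-tight edges-tight }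
      ; m'-total = m'V-total , m'E-total
      ; m'-injective = m'V-injective , m'E-injective
      }
      where
        m'-morph : Morph S L graph
        m'-morph = record { fV = m'V c ; fE = m'E c ; lab-pres = m'-lab ; att-pres = m'-att }
        r'-morph : Morph S graph G
        r'-morph = record { fV = r'V c ; fE = r'E c ; lab-pres = r'-lab ; att-pres = r'-att }

    minimal : Minimal S r m complement
    minimal = tight-minimal S complement nodes-tight edges-tight

module Trim (S : Sig) {L R G : Graph S} (r : Morph S L R) (m : Morph S R G)
            (m-total : Total S m) (m-injective : Injective S m) (c : TIPC S r m) where
  open Candidates S r m m-total m-injective

  private
    K : Graph S
    K = G' (pc c)
    μ : Morph S L K
    μ = m' (pc c)
    ρ : Morph S K G
    ρ = r' (pc c)

  open ComplementFacts S r m μ ρ (isPushout (pc c)) (m'-total c)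

  Kept : Fin (nE K) → Set
  Kept e = InImage (fE μ) e ⊎ ∃ λ g → fE ρ e ≡ just g

  open Reindexing (reindex (nE K) Kept (λ e → inImage? (fE μ) e ⊎-dec defined? (fE ρ e)))

  trimmed : Candidate (nV K) size
  trimmed = record
    { labels = λ i → lab K (embed i)
    ; attach = λ i → att K (embed i)
    ; m'V    = fV μ
    ; m'E    = λ l → fE μ l >>= index
    ; r'V    = fV ρ
    ; r'E    = λ i → fE ρ (embed i)
    }

  m'E-embed : ∀ l i → m'E trimmed l ≡ just i → fE μ l ≡ just (embed i)
  m'E-embed l i eq = let (e , μl , ie) = >>=-defined (fE μ l) index eq in
                     trans μl (cong just (sym (embed-index e i ie)))

  m'E-index : ∀ l e → fE μ l ≡ just e → ∃ λ i → index e ≡ just i × m'E trimmed l ≡ just i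
  m'E-index l e μl = let (i , ie) = index-P e (inj₁ (l , μl)) in i , ie , trans (>>=-just index μl) ie

  context : ∀ i → Context (m'E trimmed) i → Context (fE μ) (embed i)
  context i ci (l , μl) = ci (l , trans (>>=-just index μl) (index-embed i))

  -- Edges that survive trimming are images of m' or context edges that survive in G, so the
  -- edge component is tight by the structure of pushout complements.
  edges-tight : Tight (fE m) (fE r) (m'E trimmed) (r'E trimmed)
  edges-tight = record
    { commutes         = commutes
    ; context-outside  = outside
    ; context-unshared = λ i i' g ci ri ri' →
        embed-injective i' i (edge-context-unshared (embed i) (context i ci) (embed i') g ri ri')
    ; covering         = covers
    }
    where
      commutes : ∀ l → (fE r l >>= fE m) ≡ (m'E trimmed l >>= r'E trimmed)
      commutes l = let (e , μl) = proj₂ (m'-total c) l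
                       (i , ie , m'l) = m'E-index l e μl in
        trans (proj₂ (IsPushout.comm (isPushout (pc c))) l)
              (trans (>>=-just (fE ρ) μl)
                     (trans (cong (fE ρ) (sym (embed-index e i ie))) (sym (>>=-just (r'E trimmed) m'l))))

      outside : ∀ i → Context (m'E trimmed) i → ∃ λ g → r'E trimmed i ≡ just g × ¬ InImage (fE m) g
      outside i ci with embed-P i
      ... | inj₁ img       = ⊥-elim (context i ci img)
      ... | inj₂ (g , ρi) = g , ρi , edge-context-outside (embed i) (context i ci) g ρi

      covers : ∀ g → InImage (r'E trimmed) g ⊎ InImage (fE m) g
      covers g with proj₂ covering g
      ... | inj₂ img       = inj₂ img
      ... | inj₁ (e , ρe) = let (i , ie) = index-P e (inj₂ (g , ρe)) in
                            inj₁ (i , trans (cong (fE ρ) (embed-index e i ie)) ρe)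

  trimmed-valid : Valid trimmed
  trimmed-valid = record
    { arity         = λ i → att-ar K (embed i)
    ; m'-lab        = λ l i eq → lab-pres μ l (embed i) (m'E-embed l i eq)
    ; m'-att        = λ l i eq → att-pres μ l (embed i) (m'E-embed l i eq)
    ; r'-lab        = λ i g eq → lab-pres ρ (embed i) g eq
    ; r'-att        = λ i g eq → att-pres ρ (embed i) g eq
    ; m'V-total     = proj₁ (m'-total c)
    ; m'E-total     = λ l → let (e , μl) = proj₂ (m'-total c) l
                                (i , _ , m'l) = m'E-index l e μl in i , m'l
    ; m'V-injective = proj₁ (m'-injective c)
    ; m'E-injective = λ l l' i eq eq' → proj₂ (m'-injective c) l l' (embed i) (m'E-embed l i eq) (m'E-embed l' i eq')
    ; nodes-tight   = nodes-tight
    ; edges-tight   = edges-tight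
    }

  trimmed-⊑ : ∀ {d : Candidate (nV K) size} (v : Valid d) → d ≐ trimmed → _⊑_ S (Complement.graph v) K
  trimmed-⊑ {d} v (lab≗ , att≗ , _) = σ , σ-injective , σ-surjective
    where
      σ : Morph S K (Complement.graph v)
      σ = record
        { fV = just
        ; fE = index
        ; lab-pres = λ e i ie → trans (lab≗ i) (cong (lab K) (embed-index e i ie))
        ; att-pres = λ e i ie → cong (map just) (sym (trans (att≗ i) (cong (att K) (embed-index e i ie))))
        }
      σ-injective : Injective S σ
      σ-injective = (λ v v' w e e' → just-injective (trans e (sym e')))
                  , (λ e e' i ie ie' → trans (sym (embed-index e i ie)) (embed-index e' i ie'))
      σ-surjective : Surjective S σ
      σ-surjective = (λ w → w , refl) , (λ i → embed i , index-embed i)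

any-concatMap : ∀ {A B : Set} {P : B → Set} (f : A → List B) {a : A} {xs : List A} →
                a ∈ xs → Any P (f a) → Any P (concatMap f xs)
any-concatMap f a∈xs p = AnyP.concatMap⁺ f (lose a∈xs p)

all-concatMap : ∀ {A B : Set} {P : B → Set} (f : A → List B) → (∀ a → All P (f a)) →
                ∀ xs → All P (concatMap f xs)
all-concatMap f all-f xs = AllP.concat⁺ (AllP.map⁺ (All.universal all-f xs))

sequences : ∀ {A : Set} → List A → ℕ → List (List A)
sequences xs zero    = [] ∷ []
sequences xs (suc n) = cartesianProductWith _∷_ xs (sequences xs n)

sequences-complete : ∀ {A : Set} {xs : List A} → (∀ a → a ∈ xs) → ∀ ys → ys ∈ sequences xs (length ys)
sequences-complete every []       = here refl
sequences-complete every (y ∷ ys) = ∈-cartesianProductWith⁺ _∷_ (every y) (sequences-complete every ys)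

vectors : ∀ {A : Set} → List A → (n : ℕ) → List (Vec A n)
vectors xs zero    = Vec.[] ∷ []
vectors xs (suc n) = cartesianProductWith Vec._∷_ xs (vectors xs n)

vectors-complete : ∀ {A : Set} {xs : List A} n (f : Fin n → A) → (∀ i → f i ∈ xs) → tabulate f ∈ vectors xs n
vectors-complete zero    f f∈ = here refl
vectors-complete (suc n) f f∈ =
  ∈-cartesianProductWith⁺ Vec._∷_ (f∈ zero) (vectors-complete n (λ i → f (suc i)) (λ i → f∈ (suc i)))

maybes : ∀ n → List (Maybe (Fin n))
maybes n = nothing ∷ map just (allFin n)

maybes-complete : ∀ n (p : Maybe (Fin n)) → p ∈ maybes n
maybes-complete n nothing  = here refl
maybes-complete n (just y) = there (∈-map⁺ just (∈-allFin y))

module Enumeration (S : Sig) {L R G : Graph S} (r : Morph S L R) (m : Morph S R G)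
                   (m-total : Total S m) (m-injective : Injective S m) where
  open Sig S
  open Candidates S r m m-total m-injective

  -- Candidate data as vectors, which can be listed exhaustively.
  Raw : ℕ → ℕ → Set
  Raw N M = Vec (Fin nLab × List (Fin N)) M × Vec (Maybe (Fin N)) (nV L) × Vec (Maybe (Fin M)) (nE L)
          × Vec (Maybe (Fin (nV G))) N × Vec (Maybe (Fin (nE G))) M

  decode : ∀ {N M} → Raw N M → Candidate N M
  decode (es , mV , mE , rV , rE) = record
    { labels = λ e → proj₁ (lookup es e) ; attach = λ e → proj₂ (lookup es e)
    ; m'V = lookup mV ; m'E = lookup mE ; r'V = lookup rV ; r'E = lookup rE }

  encode : ∀ {N M} → Candidate N M → Raw N M
  encode c = tabulate (λ e → labels c e , attach c e) , tabulate (m'V c) , tabulate (m'E c)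
           , tabulate (r'V c) , tabulate (r'E c)

  decode-encode : ∀ {N M} (c : Candidate N M) → decode (encode c) ≐ c
  decode-encode c = (λ e → cong proj₁ (lookup∘tabulate _ e)) , (λ e → cong proj₂ (lookup∘tabulate _ e))
                  , lookup∘tabulate (m'V c) , lookup∘tabulate (m'E c) , lookup∘tabulate (r'V c) , lookup∘tabulate (r'E c)

  edgeShapes : (N : ℕ) → List (Fin nLab × List (Fin N))
  edgeShapes N = concatMap (λ ℓ → map (ℓ ,_) (sequences (allFin N) (ar ℓ))) (allFin nLab)

  raws : (N M : ℕ) → List (Raw N M)
  raws N M = cartesianProduct (vectors (edgeShapes N) M)
            (cartesianProduct (vectors (maybes N) (nV L))
            (cartesianProduct (vectors (maybes M) (nE L))
            (cartesianProduct (vectors (maybes (nV G)) N) (vectors (maybes (nE G)) M))))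

  encode-complete : ∀ {N M} (c : Candidate N M) → (∀ e → length (attach c e) ≡ ar (labels c e)) →
                    encode c ∈ raws N M
  encode-complete {N} {M} c arity =
    ∈-cartesianProduct⁺ (vectors-complete M _ shape∈)
    (∈-cartesianProduct⁺ (vectors-complete (nV L) _ (λ _ → maybes-complete _ _))
    (∈-cartesianProduct⁺ (vectors-complete (nE L) _ (λ _ → maybes-complete _ _))
    (∈-cartesianProduct⁺ (vectors-complete N _ (λ _ → maybes-complete _ _))
                         (vectors-complete M _ (λ _ → maybes-complete _ _)))))
    where
      shape∈ : ∀ e → (labels c e , attach c e) ∈ edgeShapes N
      shape∈ e = any-concatMap _ (∈-allFin (labels c e))
                   (∈-map⁺ (labels c e ,_)
                     (subst (λ n → attach c e ∈ sequences (allFin N) n) (arity e)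
                            (sequences-complete ∈-allFin (attach c e))))

  complementsOf : ∀ {N M} (c : Candidate N M) → Dec (Valid c) → List (TIPC S r m)
  complementsOf c (yes v) = Complement.complement v ∷ []
  complementsOf c (no _)  = []

  complementsOfSize : (N M : ℕ) → List (TIPC S r m)
  complementsOfSize N M = concatMap (λ raw → complementsOf (decode raw) (valid? (decode raw))) (raws N M)

  -- Tight components have at most |L| + |G| items, which bounds the search.
  tightComplements : List (TIPC S r m)
  tightComplements = concatMap (λ N → concatMap (complementsOfSize N) (upTo (suc (nE L + nE G))))
                               (upTo (suc (nV L + nV G)))

  all-minimal : All (Minimal S r m) tightComplements
  all-minimal =
    all-concatMap _ (λ N → all-concatMap _ (λ M →
      all-concatMap _ (λ raw → minimal-of (valid? (decode raw))) (raws N M)) (upTo (suc (nE L + nE G))))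
      (upTo (suc (nV L + nV G)))
    where
      minimal-of : ∀ {N M} {c : Candidate N M} (d : Dec (Valid c)) → All (Minimal S r m) (complementsOf c d)
      minimal-of (yes v) = Complement.minimal v ∷ []
      minimal-of (no _)  = []

  -- A minimal complement is isomorphic to its trimming, which is listed.
  covers-minimal : ∀ (c : TIPC S r m) → Minimal S r m c → Any (λ d → _≅_ S (G' (pc c)) (G' (pc d))) tightComplements
  covers-minimal c minimal =
    any-concatMap _ (∈-upTo⁺ (s≤s (TightSize.bounded nodes-tight)))
      (any-concatMap _ (∈-upTo⁺ (s≤s (TightSize.bounded edges-tight)))
        (any-concatMap _ (encode-complete trimmed (Valid.arity trimmed-valid)) (listed (valid? (decode (encode trimmed))))))
    where
      open Trim S r m m-total m-injective c
      open ComplementFacts S r m (m' (pc c)) (r' (pc c)) (isPushout (pc c)) (m'-total c) using (nodes-tight)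

      listed : (d : Dec (Valid (decode (encode trimmed)))) →
               Any (λ d → _≅_ S (G' (pc c)) (G' (pc d))) (complementsOf (decode (encode trimmed)) d)
      listed (yes v) = here (minimal-absorbs S c minimal (Complement.complement v) (trimmed-⊑ v (decode-encode trimmed)))
      listed (no ¬v) = ⊥-elim (¬v (valid-resp (decode-encode trimmed) trimmed-valid))

lemma10 : (S : Sig) {L R G : Graph S} (r : Morph S L R) (m : Morph S R G) →
          Total S m → Injective S m →
          Σ (List (TIPC S r m)) λ Ms →
            All (Minimal S r m) Ms ×
            (∀ (c : TIPC S r m) → Minimal S r m c →
               Any (λ d → _≅_ S (G' (pc c)) (G' (pc d))) Ms)
lemma10 S r m m-total m-injective = tightComplements , all-minimal , covers-minimal
  where open Enumeration S r m m-total m-injective
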